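{- Let $q$ be a prime power, let $\mathcal{A}\subseteq\mathbb{F}_q^{3\times4}$ be a set of $q^8$ matrices with $\operatorname{rank}(\mathbf{A}-\mathbf{B})\geq2$ for all distinct $\mathbf{A},\mathbf{B}\in\mathcal{A}$, let $\mathcal{L}=\{\langle(\mathbf{I}_3|\mathbf{A})\rangle:\mathbf{A}\in\mathcal{A}\}$ (row spaces in $\mathbb{F}_q^7$), and let $S=\{x\in\mathbb{F}_q^7:x_1=x_2=x_3=0\}$. Then a $2$-dimensional subspace of $\mathbb{F}_q^7$ is contained in some member of $\mathcal{L}$ if and only if it intersects $S$ trivially. -}

module Defs where

open import Level using (0ℓ)
open import Data.Nat as ℕ using (ℕ; suc; _^_)
open import Data.Nat.Primality using (Prime)
open import Data.Fin using (Fin; splitAt; _≟_; toℕ) renaming (zero to fzero; suc to fsuc)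
open import Data.Sum using (_⊎_; inj₁; inj₂)
open import Data.Product using (Σ; ∃; ∃-syntax; _×_; _,_)
open import Data.Empty using (⊥)
open import Function.Bundles using (_↔_)
open import Relation.Nullary using (¬_; yes; no)
open import Relation.Binary.PropositionalEquality using (_≡_)
open import Relation.Binary.Definitions using (DecidableEquality)
open import Algebra.Structures using (IsCommutativeRing)

IsPrimePower : ℕ → Set
IsPrimePower q = ∃[ p ] ∃[ k ] (Prime p × q ≡ p ^ suc k)

record FiniteField (q : ℕ) : Set₁ where
  field
    Carrier : Set
    _+_ _*_ : Carrier → Carrier → Carrier
    -_      : Carrier → Carrier
    0# 1#   : Carrier
    isCommutativeRing : IsCommutativeRing _≡_ _+_ _*_ -_ 0# 1#
    _⁻¹     : Carrier → Carrier
    ⁻¹-inverse : ∀ x → ¬ (x ≡ 0#) → x * (x ⁻¹) ≡ 1#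
    0≢1     : ¬ (0# ≡ 1#)
    _≟F_    : DecidableEquality Carrier
    enumeration : Carrier ↔ Fin q

  infixl 6 _+_
  infixl 7 _*_

module LinAlg {q : ℕ} (F : FiniteField q) where
  open FiniteField F

  Vec : ℕ → Set
  Vec n = Fin n → Carrier

  Mat : ℕ → ℕ → Set
  Mat m n = Fin m → Fin n → Carrier

  Σ[_]_ : (n : ℕ) → (Fin n → Carrier) → Carrier
  Σ[ ℕ.zero ] f = 0#
  Σ[ suc n ] f = f fzero + Σ[ n ] (λ i → f (fsuc i))

  _≈_ : ∀ {n} → Vec n → Vec n → Set
  x ≈ y = ∀ k → x k ≡ y k

  zeroV : ∀ {n} → Vec n
  zeroV _ = 0#

  lincomb : ∀ {k n} → (Fin k → Carrier) → (Fin k → Vec n) → Vec n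
  lincomb {k} c v j = Σ[ k ] (λ i → c i * v i j)

  LinIndep : ∀ {k n} → (Fin k → Vec n) → Set
  LinIndep {k} v = ∀ c → lincomb c v ≈ zeroV → ∀ i → c i ≡ 0#

  RankAtLeast : ∀ {m n} → ℕ → Mat m n → Set
  RankAtLeast {m} r M = Σ (Fin r → Fin m) λ ρ → LinIndep (λ i → M (ρ i))

  _-ᴹ_ : ∀ {m n} → Mat m n → Mat m n → Mat m n
  (A -ᴹ B) i j = A i j + (- B i j)

  RowSpace : ∀ {m n} → Mat m n → Vec n → Set
  RowSpace {m} M x = Σ (Fin m → Carrier) λ c → lincomb c M ≈ x

  identity : (m : ℕ) → Mat m m
  identity m i j with i ≟ j
  ... | yes _ = 1#
  ... | no _  = 0#

  augment : ∀ {m n₁ n₂} → Mat m n₁ → Mat m n₂ → Mat m (n₁ ℕ.+ n₂)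
  augment {n₁ = n₁} A B i j with splitAt n₁ j
  ... | inj₁ j₁ = A i j₁
  ... | inj₂ j₂ = B i j₂

  pair : ∀ {n} → Vec n → Vec n → Fin 2 → Vec n
  pair u v fzero = u
  pair u v (fsuc _) = v

  Span2 : ∀ {n} → Vec n → Vec n → Vec n → Set
  Span2 u v x = ∃[ a ] ∃[ b ] (∀ k → a * u k + b * v k ≡ x k)

  InS : Vec 7 → Set
  InS x = ∀ (k : Fin 7) → toℕ k ℕ.< 3 → x k ≡ 0#

module Submission where

-- Proof idea.  Write every x ∈ 𝔽_q⁷ as (x_L | x_R) with x_L ∈ 𝔽_q³ and x_R ∈ 𝔽_q⁴; the
-- row space of (I₃ | A) consists exactly of the vectors (c | c A).
--
-- (⇒) A vector (c | c A) whose first three coordinates vanish has c = 0, hence is zero.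
-- (⇐) If ⟨u, v⟩ ∩ S = 0, the left parts u_L, v_L are linearly independent.  For i ≠ j the
--     difference A_i − A_j has rank ≥ 2, so its left kernel (inside 𝔽_q³) cannot contain the
--     two independent vectors u_L, v_L; hence the "profile" i ↦ (u_L A_i, v_L A_i) ∈ 𝔽_q⁸ is
--     injective.  It maps a set of q⁸ codewords into a set of q⁸ vectors, so by the
--     pigeonhole principle it is onto; some i has u_L A_i = u_R and v_L A_i = v_R, i.e.
--     u, v (and so all of ⟨u, v⟩) lie in the row space of (I₃ | A_i).

open import Defs
open import Data.Nat using (ℕ; _^_)
open import Data.Fin using (Fin)
open import Data.Product using (∃; ∃-syntax; _×_; _,_)
open import Relation.Nullary using (¬_)
open import Relation.Binary.PropositionalEquality using (_≡_)
open import Function.Bundles using (_⇔_)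

open import Level using (0ℓ)
open import Data.Nat as ℕ using (zero; suc; s≤s)
open import Data.Nat.Properties using (1+n≰n)
open import Data.Fin using (splitAt; join; _↑ˡ_; _↑ʳ_; punchIn; punchOut; funToFin; finToFun; _≟_)
  renaming (zero to fzero; suc to fsuc)
open import Data.Fin.Properties
  using (any?; all?; injective⇒≤; punchOut-injective; punchInᵢ≢i; punchIn-punchOut; punchIn-injective;
         join-splitAt; splitAt-↑ˡ; toℕ-↑ˡ; toℕ<n; finToFun-funToFin)
open import Data.Vec.Functional using (_∷_; []; _++_)
open import Data.Vec.Functional.Properties using (++-injective)
open import Data.Product using (proj₁; proj₂)
open import Data.Sum using (_⊎_; inj₁; inj₂; [_,_]′)
open import Data.Empty using (⊥; ⊥-elim)
open import Function using (_∘_)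
open import Function.Bundles using (Inverse; Injection; mk⇔)
open import Function.Definitions using (Injective)
open import Function.Properties.Inverse using (Inverse⇒Injection)
open import Relation.Nullary using (Dec; yes; no; contradiction)
open import Relation.Nullary.Decidable using (toWitness; _⊎-dec_)
open import Relation.Binary.PropositionalEquality
  using (_≢_; refl; sym; trans; cong; cong₂; subst; module ≡-Reasoning)
open import Algebra.Bundles using (CommutativeRing)

injective⇒surjective : ∀ {n} (f : Fin n → Fin n) → Injective _≡_ _≡_ f → ∀ t → ∃ λ i → f i ≡ t
injective⇒surjective {zero} f inj ()
injective⇒surjective {suc n} f inj t with any? (λ i → f i ≟ t)
... | yes hit = hit
... | no miss = contradiction (injective⇒≤ {f = avoid} avoid-injective) 1+n≰n
  where
  -- f never hits t, so it factors injectively through Fin n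
  avoid : Fin (suc n) → Fin n
  avoid x = punchOut {i = t} (λ e → miss (x , sym e))
  avoid-injective : Injective _≡_ _≡_ avoid
  avoid-injective {x} {y} e = inj (punchOut-injective {i = t} (λ e → miss (x , sym e)) (λ e → miss (y , sym e)) e)

-- Checked by exhaustive computation; kept opaque so that later proofs never unfold
-- the decision procedure.
opaque
  third : (r₀ r₁ : Fin 3) → r₀ ≢ r₁ → ∃ λ t → ∀ k → k ≡ r₀ ⊎ k ≡ r₁ ⊎ k ≡ t
  third r₀ r₁ r₀≢r₁ with toWitness {a? = decision} _ r₀ r₁
    where
    decision : Dec (∀ (r₀ r₁ : Fin 3) → r₀ ≡ r₁ ⊎ ∃ λ t → ∀ k → k ≡ r₀ ⊎ k ≡ r₁ ⊎ k ≡ t)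
    decision = all? λ r₀ → all? λ r₁ → (r₀ ≟ r₁) ⊎-dec any? λ t → all? λ k → (k ≟ r₀) ⊎-dec (k ≟ r₁) ⊎-dec (k ≟ t)
  ... | inj₁ r₀≡r₁ = contradiction r₀≡r₁ r₀≢r₁
  ... | inj₂ cover = cover

module LinearAlgebra {q : ℕ} (F : FiniteField q) where
  open FiniteField F
  open LinAlg F

  commutativeRing : CommutativeRing 0ℓ 0ℓ
  commutativeRing = record { isCommutativeRing = isCommutativeRing }

  open CommutativeRing commutativeRing
    using (semiring; ring; +-identityʳ; *-identityˡ; *-identityʳ; zeroˡ; zeroʳ;
           -‿inverseʳ; distribˡ; distribʳ; *-assoc; *-comm)
  open import Algebra.Properties.Semiring.Sum semiring
    using (sum; sum-cong-≗; sum-remove; sum-replicate-zero; ∑-distrib-+; *-distribˡ-sum)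
  open import Algebra.Properties.Ring ring using (-‿distribˡ-*; -‿distribʳ-*; -1*x≈-x; -0#≈0#; -‿involutive)

  Σ≡sum : ∀ n (f : Fin n → Carrier) → Σ[ n ] f ≡ sum f
  Σ≡sum zero f = refl
  Σ≡sum (suc n) f = cong (f fzero +_) (Σ≡sum n (f ∘ fsuc))

  sum-single : ∀ {n} (f : Fin n → Carrier) k → (∀ i → i ≢ k → f i ≡ 0#) → sum f ≡ f k
  sum-single {suc n} f k vanish = begin
    sum f                           ≡⟨ sum-remove {i = k} f ⟩
    f k + sum (f ∘ punchIn k)       ≡⟨ cong (f k +_) (sum-cong-≗ {n} (λ i → vanish (punchIn k i) (punchInᵢ≢i k i))) ⟩
    f k + sum {n} (λ _ → 0#)        ≡⟨ cong (f k +_) (sum-replicate-zero n) ⟩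
    f k + 0#                        ≡⟨ +-identityʳ (f k) ⟩
    f k                             ∎
    where open ≡-Reasoning

  sum-two : ∀ {n} (f : Fin n → Carrier) {r₀ r₁} (r₀≢r₁ : r₀ ≢ r₁) →
            (∀ i → i ≢ r₀ → i ≢ r₁ → f i ≡ 0#) → sum f ≡ f r₀ + f r₁
  sum-two {suc n} f {r₀} {r₁} r₀≢r₁ vanish = begin
    sum f                                  ≡⟨ sum-remove {i = r₀} f ⟩
    f r₀ + sum (f ∘ punchIn r₀)            ≡⟨ cong (f r₀ +_) (sum-single (f ∘ punchIn r₀) j off-j) ⟩
    f r₀ + f (punchIn r₀ j)                ≡⟨ cong (λ r → f r₀ + f r) (punchIn-punchOut r₀≢r₁) ⟩
    f r₀ + f r₁                            ∎
    where
    open ≡-Reasoning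
    j = punchOut r₀≢r₁
    off-j : ∀ i → i ≢ j → f (punchIn r₀ i) ≡ 0#
    off-j i i≢j = vanish _ (punchInᵢ≢i r₀ i)
      (λ e → i≢j (punchIn-injective r₀ i j (trans e (sym (punchIn-punchOut r₀≢r₁)))))

  lincomb≡sum : ∀ {m n} (c : Vec m) (M : Mat m n) j → lincomb c M j ≡ sum (λ i → c i * M i j)
  lincomb≡sum {m} c M j = Σ≡sum m (λ i → c i * M i j)

  lincomb-zero : ∀ {m n} (c : Vec m) (M : Mat m n) → c ≈ zeroV → lincomb c M ≈ zeroV
  lincomb-zero {m} c M c≈0 j = begin
    lincomb c M j                 ≡⟨ lincomb≡sum c M j ⟩
    sum (λ i → c i * M i j)       ≡⟨ sum-cong-≗ (λ i → trans (cong (_* M i j) (c≈0 i)) (zeroˡ (M i j))) ⟩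
    sum {m} (λ _ → 0#)            ≡⟨ sum-replicate-zero m ⟩
    0#                            ∎
    where open ≡-Reasoning

  lincomb-linear : ∀ {m n} a b (c d : Vec m) (M : Mat m n) j →
                   lincomb (λ i → a * c i + b * d i) M j ≡ a * lincomb c M j + b * lincomb d M j
  lincomb-linear a b c d M j = begin
    lincomb (λ i → a * c i + b * d i) M j
      ≡⟨ lincomb≡sum _ M j ⟩
    sum (λ i → (a * c i + b * d i) * M i j)
      ≡⟨ sum-cong-≗ (λ i → trans (distribʳ (M i j) (a * c i) (b * d i))
                                 (cong₂ _+_ (*-assoc a (c i) (M i j)) (*-assoc b (d i) (M i j)))) ⟩
    sum (λ i → a * (c i * M i j) + b * (d i * M i j))
      ≡⟨ ∑-distrib-+ (λ i → a * (c i * M i j)) (λ i → b * (d i * M i j)) ⟩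
    sum (λ i → a * (c i * M i j)) + sum (λ i → b * (d i * M i j))
      ≡⟨ cong₂ _+_ (*-distribˡ-sum a (λ i → c i * M i j)) (*-distribˡ-sum b (λ i → d i * M i j)) ⟨
    a * sum (λ i → c i * M i j) + b * sum (λ i → d i * M i j)
      ≡⟨ cong₂ (λ s t → a * s + b * t) (lincomb≡sum c M j) (lincomb≡sum d M j) ⟨
    a * lincomb c M j + b * lincomb d M j
      ∎
    where open ≡-Reasoning

  lincomb-sub : ∀ {m n} (c : Vec m) (A B : Mat m n) j →
                lincomb c (A -ᴹ B) j ≡ lincomb c A j + - lincomb c B j
  lincomb-sub c A B j = begin
    lincomb c (A -ᴹ B) j
      ≡⟨ lincomb≡sum c (A -ᴹ B) j ⟩
    sum (λ i → c i * (A i j + - B i j))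
      ≡⟨ sum-cong-≗ (λ i → trans (distribˡ (c i) (A i j) (- B i j))
                                 (cong (c i * A i j +_) (trans (sym (-‿distribʳ-* (c i) (B i j))) (sym (-1*x≈-x _))))) ⟩
    sum (λ i → c i * A i j + - 1# * (c i * B i j))
      ≡⟨ ∑-distrib-+ (λ i → c i * A i j) (λ i → - 1# * (c i * B i j)) ⟩
    sum (λ i → c i * A i j) + sum (λ i → - 1# * (c i * B i j))
      ≡⟨ cong (sum (λ i → c i * A i j) +_) (*-distribˡ-sum (- 1#) (λ i → c i * B i j)) ⟨
    sum (λ i → c i * A i j) + - 1# * sum (λ i → c i * B i j)
      ≡⟨ cong₂ _+_ (lincomb≡sum c A j) (trans (cong -_ (lincomb≡sum c B j)) (sym (-1*x≈-x _))) ⟨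
    lincomb c A j + - lincomb c B j
      ∎
    where open ≡-Reasoning

  lincomb-identity : ∀ {m} (c : Vec m) → lincomb c (identity m) ≈ c
  lincomb-identity c k = begin
    lincomb c (identity _) k                ≡⟨ lincomb≡sum c (identity _) k ⟩
    sum (λ i → c i * identity _ i k)        ≡⟨ sum-single _ k (λ i i≢k → trans (cong (c i *_) (off-diagonal i≢k)) (zeroʳ (c i))) ⟩
    c k * identity _ k k                    ≡⟨ cong (c k *_) diagonal ⟩
    c k * 1#                                ≡⟨ *-identityʳ (c k) ⟩
    c k                                     ∎
    where
    open ≡-Reasoning
    diagonal : identity _ k k ≡ 1#
    diagonal with k ≟ k
    ... | yes _   = refl
    ... | no k≢k = contradiction refl k≢k
    off-diagonal : ∀ {i} → i ≢ k → identity _ i k ≡ 0#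
    off-diagonal {i} i≢k with i ≟ k
    ... | yes i≡k = contradiction i≡k i≢k
    ... | no _    = refl

  lincomb-augment-identity : ∀ {m n} (c : Vec m) (A : Mat m n) k →
                             lincomb c (augment (identity m) A) k ≡ [ c , lincomb c A ]′ (splitAt m k)
  lincomb-augment-identity {m} c A k with splitAt m k
  ... | inj₁ j = lincomb-identity c j
  ... | inj₂ j = refl

  rowSpace-span : ∀ {m n} (M : Mat m n) {u v x : Vec n} →
                  RowSpace M u → RowSpace M v → Span2 u v x → RowSpace M x
  rowSpace-span M (c , cM≈u) (d , dM≈v) (a , b , ab≈x) =
    (λ i → a * c i + b * d i) ,
    λ j → trans (lincomb-linear a b c d M j) (trans (cong₂ (λ s t → a * s + b * t) (cM≈u j) (dM≈v j)) (ab≈x j))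

  inRowSpace : ∀ {m n} (A : Mat m n) (x : Vec (m ℕ.+ n)) →
               (∀ j → lincomb (x ∘ (_↑ˡ n)) A j ≡ x (m ↑ʳ j)) → RowSpace (augment (identity m) A) x
  inRowSpace {m} {n} A x right≈ = x ∘ (_↑ˡ n) , λ k →
    trans (lincomb-augment-identity _ A k) (trans (agree (splitAt m k)) (cong x (join-splitAt m n k)))
    where
    agree : ∀ s → [ x ∘ (_↑ˡ n) , lincomb (x ∘ (_↑ˡ n)) A ]′ s ≡ x (join m n s)
    agree (inj₁ j) = refl
    agree (inj₂ j) = right≈ j

  rowSpace-left-zero : ∀ {m n} (A : Mat m n) {x : Vec (m ℕ.+ n)} → RowSpace (augment (identity m) A) x →
                       (∀ k → x (k ↑ˡ n) ≡ 0#) → x ≈ zeroV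
  rowSpace-left-zero {m} {n} A {x} (c , c[I|A]≈x) left≈0 k =
    trans (sym (c[I|A]≈x k)) (lincomb-zero c (augment (identity m) A) c≈0 k)
    where
    c≈0 : c ≈ zeroV
    c≈0 k = begin
      c k                                            ≡⟨ cong [ c , lincomb c A ]′ (splitAt-↑ˡ m k n) ⟨
      [ c , lincomb c A ]′ (splitAt m (k ↑ˡ n))      ≡⟨ lincomb-augment-identity c A (k ↑ˡ n) ⟨
      lincomb c (augment (identity m) A) (k ↑ˡ n)    ≡⟨ c[I|A]≈x (k ↑ˡ n) ⟩
      x (k ↑ˡ n)                                     ≡⟨ left≈0 k ⟩
      0#                                             ∎
      where open ≡-Reasoning

  -x≈0⇒x≈0 : ∀ {x} → - x ≡ 0# → x ≡ 0#
  -x≈0⇒x≈0 {x} -x≈0 = trans (sym (-‿involutive x)) (trans (cong -_ -x≈0) -0#≈0#)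

  pair-independent : ∀ {n} {x y : Vec n} → LinIndep (pair x y) →
                     ∀ a b → (∀ k → a * x k + b * y k ≡ 0#) → a ≡ 0# × b ≡ 0#
  pair-independent {x = x} {y} indep a b ax+by≈0 = indep (a ∷ b ∷ []) lc fzero , indep (a ∷ b ∷ []) lc (fsuc fzero)
    where
    lc : lincomb (a ∷ b ∷ []) (pair x y) ≈ zeroV
    lc k = trans (cong (a * x k +_) (+-identityʳ (b * y k))) (ax+by≈0 k)

  equal⇒dependent : ∀ {n} (x y : Vec n) → x ≈ y → ¬ LinIndep (pair x y)
  equal⇒dependent x y x≈y indep = 0≢1 (sym (proj₁ (pair-independent indep 1# (- 1#) x-x≈0)))
    where
    x-x≈0 : ∀ k → 1# * x k + - 1# * y k ≡ 0#
    x-x≈0 k = trans (cong₂ _+_ (*-identityˡ (x k)) (trans (-1*x≈-x (y k)) (cong -_ (sym (x≈y k)))))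
                    (-‿inverseʳ (x k))

  -- Let rows r₀ ≠ r₁ of a 3-row matrix M be independent and t the remaining index.  A vector y
  -- with y M = 0 and y_t = 0 gives y_{r₀} M_{r₀} + y_{r₁} M_{r₁} = 0, so y = 0.
  kernel-vanishing-at-third : ∀ {n} (M : Mat 3 n) {r₀ r₁ t} → r₀ ≢ r₁ → (∀ k → k ≡ r₀ ⊎ k ≡ r₁ ⊎ k ≡ t) →
                              LinIndep (pair (M r₀) (M r₁)) →
                              ∀ y → y t ≡ 0# → lincomb y M ≈ zeroV → y ≈ zeroV
  kernel-vanishing-at-third M {r₀} {r₁} {t} r₀≢r₁ cover rows-indep y yt≈0 yM≈0 k
    with cover k | pair-independent rows-indep (y r₀) (y r₁) two-rows
    where
    off-rows : ∀ j i → i ≢ r₀ → i ≢ r₁ → y i * M i j ≡ 0#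
    off-rows j i i≢r₀ i≢r₁ with cover i
    ... | inj₁ i≡r₀        = contradiction i≡r₀ i≢r₀
    ... | inj₂ (inj₁ i≡r₁) = contradiction i≡r₁ i≢r₁
    ... | inj₂ (inj₂ refl) = trans (cong (_* M t j) yt≈0) (zeroˡ (M t j))
    two-rows : ∀ j → y r₀ * M r₀ j + y r₁ * M r₁ j ≡ 0#
    two-rows j = trans (sym (sum-two _ r₀≢r₁ (off-rows j))) (trans (sym (lincomb≡sum y M j)) (yM≈0 j))
  ... | inj₁ refl        | yr₀≈0 , _ = yr₀≈0
  ... | inj₂ (inj₁ refl) | _ , yr₁≈0 = yr₁≈0
  ... | inj₂ (inj₂ refl) | _         = yt≈0

  -- Left-kernel bound for 3-row matrices: if M has two linearly independent rows, then no two
  -- linearly independent vectors w, z satisfy w M = z M = 0.  (Otherwise y = z_t w − w_t z is a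
  -- kernel vector vanishing at the third index t, so y = 0, which forces w_t = 0 and then w = 0.)
  rank≥2⇒no-independent-kernel-pair : ∀ {n} (M : Mat 3 n) → RankAtLeast 2 M → (w z : Vec 3) →
                                      LinIndep (pair w z) → lincomb w M ≈ zeroV → lincomb z M ≈ zeroV → ⊥
  rank≥2⇒no-independent-kernel-pair M (ρ , rows-indep) w z wz-indep wM≈0 zM≈0 with ρ fzero ≟ ρ (fsuc fzero)
  ... | yes r₀≡r₁ = equal⇒dependent (M (ρ fzero)) (M (ρ (fsuc fzero))) (λ j → cong (λ r → M r j) r₀≡r₁) rows-indep
  ... | no r₀≢r₁ = 0≢1 (sym (proj₁ (pair-independent wz-indep 1# 0# w-alone≈0)))
    where
    t : Fin 3
    t = proj₁ (third (ρ fzero) (ρ (fsuc fzero)) r₀≢r₁)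
    kernel-vanishes : ∀ y → y t ≡ 0# → lincomb y M ≈ zeroV → y ≈ zeroV
    kernel-vanishes = kernel-vanishing-at-third M r₀≢r₁ (proj₂ (third _ _ r₀≢r₁)) rows-indep

    y : Vec 3
    y k = z t * w k + - w t * z k
    yt≈0 : y t ≡ 0#
    yt≈0 = trans (cong₂ _+_ (*-comm (z t) (w t)) (sym (-‿distribˡ-* (w t) (z t)))) (-‿inverseʳ (w t * z t))
    yM≈0 : lincomb y M ≈ zeroV
    yM≈0 j = begin
      lincomb y M j                                      ≡⟨ lincomb-linear (z t) (- w t) w z M j ⟩
      z t * lincomb w M j + - w t * lincomb z M j        ≡⟨ cong₂ (λ s s′ → z t * s + - w t * s′) (wM≈0 j) (zM≈0 j) ⟩
      z t * 0# + - w t * 0#                              ≡⟨ cong₂ _+_ (zeroʳ (z t)) (zeroʳ (- w t)) ⟩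
      0# + 0#                                            ≡⟨ +-identityʳ 0# ⟩
      0#                                                 ∎
      where open ≡-Reasoning
    wt≈0 : w t ≡ 0#
    wt≈0 = -x≈0⇒x≈0 (proj₂ (pair-independent wz-indep (z t) (- w t) (kernel-vanishes y yt≈0 yM≈0)))
    w-alone≈0 : ∀ k → 1# * w k + 0# * z k ≡ 0#
    w-alone≈0 k = trans (cong₂ _+_ (trans (*-identityˡ (w k)) (kernel-vanishes w wt≈0 wM≈0 k)) (zeroˡ (z k)))
                        (+-identityʳ 0#)

  encode : ∀ {n} → Vec n → Fin (q ^ n)
  encode x = funToFin (Inverse.to enumeration ∘ x)

  encode-injective : ∀ {n} {x y : Vec n} → encode x ≡ encode y → x ≈ y
  encode-injective {x = x} {y} e k = Injection.injective (Inverse⇒Injection enumeration) (begin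
    Inverse.to enumeration (x k)  ≡⟨ finToFun-funToFin (Inverse.to enumeration ∘ x) k ⟨
    finToFun (encode x) k         ≡⟨ cong (λ i → finToFun i k) e ⟩
    finToFun (encode y) k         ≡⟨ finToFun-funToFin (Inverse.to enumeration ∘ y) k ⟩
    Inverse.to enumeration (y k)  ∎)
    where open ≡-Reasoning

  profile-injective : ∀ {N n} (𝒜 : Fin N → Mat 3 n) → (∀ i j → i ≢ j → RankAtLeast 2 (𝒜 i -ᴹ 𝒜 j)) →
                      (w z : Vec 3) → LinIndep (pair w z) → ∀ i j →
                      lincomb w (𝒜 i) ≈ lincomb w (𝒜 j) → lincomb z (𝒜 i) ≈ lincomb z (𝒜 j) → i ≡ j
  profile-injective 𝒜 rank-distance w z wz-indep i j wAᵢ≈wAⱼ zAᵢ≈zAⱼ with i ≟ j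
  ... | yes i≡j = i≡j
  ... | no i≢j  = ⊥-elim (rank≥2⇒no-independent-kernel-pair (𝒜 i -ᴹ 𝒜 j) (rank-distance i j i≢j) w z wz-indep
                                                            (in-kernel {w} wAᵢ≈wAⱼ) (in-kernel {z} zAᵢ≈zAⱼ))
    where
    in-kernel : ∀ {c} → lincomb c (𝒜 i) ≈ lincomb c (𝒜 j) → lincomb c (𝒜 i -ᴹ 𝒜 j) ≈ zeroV
    in-kernel {c} cAᵢ≈cAⱼ k = trans (lincomb-sub c (𝒜 i) (𝒜 j) k)
                                    (trans (cong (_+ - lincomb c (𝒜 j) k) (cAᵢ≈cAⱼ k)) (-‿inverseʳ _))

  -- Counting: a code of q^(2n) such matrices has q^(2n) distinct profiles (w A, z A), as many as
  -- there are pairs in 𝔽_qⁿ × 𝔽_qⁿ; so every pair (r, s) is the profile of some codeword.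
  profile-surjective : ∀ {n} (𝒜 : Fin (q ^ (n ℕ.+ n)) → Mat 3 n) →
                       (∀ i j → i ≢ j → RankAtLeast 2 (𝒜 i -ᴹ 𝒜 j)) →
                       (w z : Vec 3) → LinIndep (pair w z) → (r s : Vec n) →
                       ∃ λ i → lincomb w (𝒜 i) ≈ r × lincomb z (𝒜 i) ≈ s
  profile-surjective 𝒜 rank-distance w z wz-indep r s =
    let i , hit = injective⇒surjective profile profile-inj (encode (r ++ s))
    in  i , ++-injective _ _ (encode-injective hit)
    where
    profile : Fin _ → Fin _
    profile i = encode (lincomb w (𝒜 i) ++ lincomb z (𝒜 i))
    profile-inj : Injective _≡_ _≡_ profile
    profile-inj {i} {j} e =
      let wA≈ , zA≈ = ++-injective _ _ (encode-injective e)
      in  profile-injective 𝒜 rank-distance w z wz-indep i j wA≈ zA≈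

  left : Vec 7 → Vec 3
  left x = x ∘ (_↑ˡ 4)

  right : Vec 7 → Vec 4
  right x = x ∘ (3 ↑ʳ_)

  InS⇒left≈0 : ∀ {x} → InS x → left x ≈ zeroV
  InS⇒left≈0 x∈S k = x∈S (k ↑ˡ 4) (subst (ℕ._< 3) (sym (toℕ-↑ˡ k 4)) (toℕ<n k))

  left≈0⇒InS : ∀ {x} → left x ≈ zeroV → InS x
  left≈0⇒InS xL≈0 fzero                  _ = xL≈0 fzero
  left≈0⇒InS xL≈0 (fsuc fzero)           _ = xL≈0 (fsuc fzero)
  left≈0⇒InS xL≈0 (fsuc (fsuc fzero))    _ = xL≈0 (fsuc (fsuc fzero))
  left≈0⇒InS xL≈0 (fsuc (fsuc (fsuc k))) (s≤s (s≤s (s≤s ())))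

  -- If ⟨u, v⟩ meets S trivially, the left parts u_L, v_L are linearly independent: a relation
  -- between them yields a vector of ⟨u, v⟩ ∩ S, which must vanish.
  trivial⇒left-independent : (u v : Vec 7) → LinIndep (pair u v) →
                             (∀ x → Span2 u v x → InS x → x ≈ zeroV) → LinIndep (pair (left u) (left v))
  trivial⇒left-independent u v uv-indep trivial c cL≈0 =
    uv-indep c (λ k → trans (cong (c fzero * u k +_) (+-identityʳ _)) (x≈0 k))
    where
    x : Vec 7
    x k = c fzero * u k + c (fsuc fzero) * v k
    x≈0 : x ≈ zeroV
    x≈0 = trivial x (c fzero , c (fsuc fzero) , λ k → refl)
                    (left≈0⇒InS (λ k → trans (cong (c fzero * u (k ↑ˡ 4) +_) (sym (+-identityʳ _))) (cL≈0 k)))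

lemma3p1 : (q : ℕ) → IsPrimePower q → (F : FiniteField q) →
    let open FiniteField F
        open LinAlg F
    in (𝒜 : Fin (q ^ 8) → Mat 3 4) →
       (∀ i j → ¬ (i ≡ j) → RankAtLeast 2 (𝒜 i -ᴹ 𝒜 j)) →
       (u v : Vec 7) → LinIndep (pair u v) →
       (∃[ i ] (∀ x → Span2 u v x → RowSpace (augment (identity 3) (𝒜 i)) x))
       ⇔ (∀ x → Span2 u v x → InS x → x ≈ zeroV)
lemma3p1 q _ F 𝒜 rank-distance u v uv-indep = mk⇔ contained⇒trivial trivial⇒contained
  where
  open FiniteField F
  open LinAlg F
  open LinearAlgebra F

  contained⇒trivial : (∃[ i ] (∀ x → Span2 u v x → RowSpace (augment (identity 3) (𝒜 i)) x)) →
                      ∀ x → Span2 u v x → InS x → x ≈ zeroV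
  contained⇒trivial (i , ⟨u,v⟩⊆rows) x x∈⟨u,v⟩ x∈S =
    rowSpace-left-zero (𝒜 i) (⟨u,v⟩⊆rows x x∈⟨u,v⟩) (InS⇒left≈0 x∈S)

  trivial⇒contained : (∀ x → Span2 u v x → InS x → x ≈ zeroV) →
                      ∃[ i ] (∀ x → Span2 u v x → RowSpace (augment (identity 3) (𝒜 i)) x)
  trivial⇒contained trivial =
    let i , uLAᵢ≈uR , vLAᵢ≈vR = profile-surjective {n = 4} 𝒜 rank-distance (left u) (left v)
                                  (trivial⇒left-independent u v uv-indep trivial) (right u) (right v)
    in  i , λ x x∈⟨u,v⟩ → rowSpace-span (augment (identity 3) (𝒜 i)) {u} {v}
                                 (inRowSpace (𝒜 i) u uLAᵢ≈uR) (inRowSpace (𝒜 i) v vLAᵢ≈vR) x∈⟨u,v⟩
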